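{- For every prediction $\hat a>0$ and every input sequence $\sigma$ with $r=a(\sigma)/\hat a<1$, $$\mathrm{ATup}(\sigma)\ge \frac{r}{2}\,\mathrm{Opt}(\sigma)-1.$$
   Context: Online Unit Profit Knapsack: the input is a sequence $\sigma$ of items with sizes in $(0,1]$, revealed one at a time; each must be irrevocably accepted or rejected on arrival, and the total size of accepted items (the level) may never exceed $1$. The profit is the number of accepted items. $\mathrm{Opt}(\sigma)$ is the maximum possible number of items from $\sigma$ of total size at most $1$, attained by taking as many of the smallest items as possible; $a(\sigma)$ is the average size of the items in this optimal solution. Adaptive Threshold template with a strictly decreasing threshold function $T:\{1,2,\dots\}\to(0,\infty)$: start with level $0$; for each arriving item $x$, let $N(y)$ be the number of items accepted so far with size strictly larger than $y$, and let $i=\max\{j\ge 0: N(T(j+1))=j\}$; accept $x$ (and add its size to the level) if $\mathrm{size}(x)\le T(i+1)$ and $\text{level}+\mathrm{size}(x)\le 1$, otherwise reject it. Algorithm ATup: given a prediction $\hat a>0$, run the template with $T(i)=\sqrt{\frac{\hat a}{2i}}$ for $i\ge 1$; $\mathrm{ATup}(\sigma)$ is its number of accepted items.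
   Formalization: The item sizes and the prediction $\hat a$ are taken in the rationals. -}

module Defs where

open import Data.Nat as ℕ using (ℕ; zero; suc; _⊔_)
open import Data.Integer using (+_)
open import Data.Rational as ℚ using (ℚ; 0ℚ; 1ℚ; _+_; _*_; _≤_; _<_; _/_)
open import Data.Rational.Properties using (_≤?_; _<?_; ≤-decTotalOrder)
open import Data.List using (List; []; _∷_; length; foldr; take)
open import Data.Bool using (Bool; true; false; if_then_else_)
open import Relation.Nullary.Decidable using (does)
import Data.List.Sort.InsertionSort

ℕtoℚ : ℕ → ℚ
ℕtoℚ n = + n / 1

total : List ℚ → ℚ
total = foldr _+_ 0ℚ

sublists : List ℚ → List (List ℚ)
sublists []       = [] ∷ []
sublists (x ∷ xs) = let s = sublists xs in foldr (λ ys acc → (x ∷ ys) ∷ ys ∷ acc) [] s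

Opt : List ℚ → ℕ
Opt σ = foldr (λ S m → if does (total S ≤? 1ℚ) then length S ⊔ m else m) 0 (sublists σ)

-- a(σ): average size of the items in the optimal solution consisting
-- of the Opt(σ) smallest items of σ.  (If Opt(σ) = 0, i.e. σ empty, we set 0.)

open Data.List.Sort.InsertionSort ≤-decTotalOrder using (sort)

avg : List ℚ → ℚ
avg σ with Opt σ
... | zero  = 0ℚ
... | suc k = total (take (suc k) (sort σ)) * (+ 1 / suc k)

-- Threshold comparisons for T(j) = sqrt(â / (2 j)), j ≥ 1.
-- For a positive size s:  s > T(j)  ⇔  2 j s² > â,
--                         s ≤ T(j)  ⇔  2 j s² ≤ â.

aboveT : ℚ → ℕ → ℚ → Bool
aboveT â j s = does (â <? ℕtoℚ (2 ℕ.* j) * (s * s))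

withinT : ℚ → ℕ → ℚ → Bool
withinT â j s = does (ℕtoℚ (2 ℕ.* j) * (s * s) ≤? â)

countAbove : ℚ → ℕ → List ℚ → ℕ
countAbove â j []       = 0
countAbove â j (s ∷ ss) = if aboveT â j s then suc (countAbove â j ss) else countAbove â j ss

-- i = max { j ≥ 0 : N(T(j+1)) = j }.  Since N(T(j+1)) ≤ #accepted, only
-- j ≤ #accepted can qualify; we search j = m, m-1, …, 0 (default 0).
searchIdx : ℚ → List ℚ → ℕ → ℕ
searchIdx â acc zero    = 0
searchIdx â acc (suc j) =
  if does (countAbove â (suc (suc j)) acc ℕ.≟ suc j) then suc j else searchIdx â acc j

index : ℚ → List ℚ → ℕ
index â acc = searchIdx â acc (length acc)

runAT : ℚ → List ℚ → ℚ → List ℚ → List ℚ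
runAT â acc level []      = acc
runAT â acc level (x ∷ σ) =
  if withinT â (suc (index â acc)) x ∧ᵇ does (level + x ≤? 1ℚ)
  then runAT â (x ∷ acc) (level + x) σ
  else runAT â acc level σ
  where
  _∧ᵇ_ : Bool → Bool → Bool
  true  ∧ᵇ b = b
  false ∧ᵇ _ = false

ATup : ℚ → List ℚ → ℕ
ATup â σ = length (runAT â [] 0ℚ σ)

{-# OPTIONS --safe #-}
module Submission where

-- The threshold rule keeps the invariant that, for every j, at most j accepted items
-- exceed T(j+1).  Hence the k-th largest accepted item is at most T(k), and m accepted
-- items have total at most Σₖ T(k) ≤ √(2mâ).  So if an item under the current threshold
-- is ever refused for lack of room, 1 < 2(m+1)â.  Otherwise every item under the final
-- threshold T(i+1) was accepted, and exactly i accepted items exceed it.  Let O be the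
-- Opt(σ) smallest items, of total S = a(σ)·Opt(σ) ≤ min(1, Opt(σ)·â), with p ≤ m − i of
-- them under T(i+1) and q above it.  If q ≤ p + 2(i+1) then S ≤ (p+q)â ≤ 2(m+1)â.
-- Otherwise the least t of the q large items satisfies qt ≤ S ≤ 1 and â < 2(i+1)t²,
-- whence q² < 2(i+1)(p+q), which is impossible.  Finally S ≤ 2(m+1)â rearranges to the
-- claimed bound.

open import Defs
open import Data.Rational using (ℚ; 0ℚ; 1ℚ; ½; _+_; _-_; _*_; _≤_; _<_; 1/_; Positive)
open import Data.Rational.Properties using (pos⇒nonZero)
open import Data.List using (List)
open import Data.List.Relation.Unary.All using (All)
open import Data.Product using (_×_)

open import Data.Bool using (true; false; if_then_else_)
open import Data.Nat as ℕ using (ℕ; zero; suc; z≤n; s≤s; _⊔_)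
import Data.Nat.Properties as ℕ
import Data.Nat.Tactic.RingSolver as ℕ-Solver
open import Data.Nat.Coprimality as Coprime using (1-coprimeTo)
open import Data.Integer as ℤ using (+_)
import Data.Integer.Properties as ℤ
open import Data.Rational as ℚ using (mkℚ; *≤*; *<*; NonNegative)
open import Data.Rational.Properties
open import Data.Product as Product using (_,_; proj₁; proj₂; ∃-syntax)
open import Data.Sum as Sum using (_⊎_; inj₁; inj₂)
open import Function using (id; _∘_; _$_)
open import Level using (0ℓ)
open import Relation.Binary.Bundles using (DecTotalOrder)
open import Relation.Binary.PropositionalEquality
  using (_≡_; _≢_; refl; sym; trans; cong; cong₂; subst; subst₂; setoid; module ≡-Reasoning)
open import Relation.Nullary using (¬_; Dec; yes; no; does; ¬?)
import Relation.Nullary.Decidable.Core as Dec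
open import Relation.Unary using (Decidable)

open import Data.List using ([]; _∷_; length; take; filter; foldr)
open import Data.List.Properties using (length-take; length-filter; filter-accept; filter-reject; filter-all)
open import Data.List.Membership.Propositional using (_∈_)
open import Data.List.Relation.Unary.Any using (here; there)
open import Data.List.Relation.Unary.All as All using ([]; _∷_)
open import Data.List.Relation.Unary.All.Properties using (all-filter)
open import Data.List.Relation.Unary.AllPairs using (AllPairs; []; _∷_)
open import Data.List.Relation.Unary.Sorted.TotalOrder.Properties using (Sorted⇒AllPairs)
open import Data.List.Relation.Binary.Sublist.Propositional using (_⊆_; []; _∷_; _∷ʳ_; ⊆-refl)
open import Data.List.Relation.Binary.Sublist.Propositional.Properties as Sublist
  using (∷ˡ⁻; All-resp-⊆; length-mono-≤; filter-⊆; take-⊆)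
open import Data.List.Relation.Binary.Permutation.Propositional as ↭
  using (_↭_; ↭-refl; ↭-sym; ↭-trans; ↭⇒↭ₛ)
open import Data.List.Relation.Binary.Permutation.Propositional.Properties using (↭-length; filter-↭; All-resp-↭)
open import Data.List.Relation.Binary.Permutation.Setoid.Properties (setoid ℚ) using (foldr-commMonoid)
import Data.List.Relation.Ternary.Interleaving.Propositional.Properties as Interleaving
open import Data.List.Relation.Ternary.Interleaving.Properties using (interleave-length)
open import Data.List.Sort.InsertionSort ≤-decTotalOrder using (sort)
open import Data.List.Sort.InsertionSort.Properties ≤-decTotalOrder using (sort-↭; sort-↗)
open DecTotalOrder ≤-decTotalOrder using (totalOrder)
open import Data.List.Extrema totalOrder using (min; argmin-all; min≤⊤; min≤xs)

import Tactic.RingSolver as Solver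
import Tactic.RingSolver.Core.AlmostCommutativeRing as ACR

ℚ-ring : ACR.AlmostCommutativeRing 0ℓ 0ℓ
ℚ-ring = ACR.fromCommutativeRing +-*-commutativeRing (λ x → Dec.dec⇒maybe (0ℚ ≟ x))

does-true⇒ : ∀ {P : Set} (d : Dec P) → does d ≡ true → P
does-true⇒ (yes p) _ = p
does-true⇒ (no _) ()

does-false⇒ : ∀ {P : Set} (d : Dec P) → does d ≡ false → ¬ P
does-false⇒ (no ¬p) _ = ¬p
does-false⇒ (yes _) ()

≤⇒≯ : ∀ {p q} → p ≤ q → ¬ q < p
≤⇒≯ p≤q q<p = <-irrefl refl (≤-<-trans p≤q q<p)

p≤p+q : ∀ {p q} → 0ℚ ≤ q → p ≤ p + q
p≤p+q {p} 0≤q = ≤-trans (≤-reflexive (sym (+-identityʳ p))) (+-monoʳ-≤ p 0≤q)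

square-nonNeg : ∀ x → 0ℚ ≤ x * x
square-nonNeg x with ≤-total 0ℚ x
... | inj₁ 0≤x = ≤-trans (≤-reflexive (sym (*-zeroʳ x))) (*-monoˡ-≤-nonNeg x {{ℚ.nonNegative 0≤x}} 0≤x)
... | inj₂ x≤0 = ≤-trans (≤-reflexive (sym (*-zeroʳ x))) (*-monoˡ-≤-nonPos x {{ℚ.nonPositive x≤0}} x≤0)

square-mono : ∀ {x y} → 0ℚ ≤ x → x ≤ y → x * x ≤ y * y
square-mono {x} {y} 0≤x x≤y =
  ≤-trans (*-monoˡ-≤-nonNeg x {{ℚ.nonNegative 0≤x}} x≤y)
          (*-monoʳ-≤-nonNeg y {{ℚ.nonNegative (≤-trans 0≤x x≤y)}} x≤y)

ℕtoℚ≡mkℚ : ∀ n → ℕtoℚ n ≡ mkℚ (+ n) 0 (Coprime.sym (1-coprimeTo n))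
ℕtoℚ≡mkℚ n = normalize-coprime {n} (Coprime.sym (1-coprimeTo n))

ℕtoℚ-+ : ∀ m n → ℕtoℚ (m ℕ.+ n) ≡ ℕtoℚ m + ℕtoℚ n
ℕtoℚ-+ m n rewrite ℕtoℚ≡mkℚ m | ℕtoℚ≡mkℚ n =
  cong₂ (λ a b → (a ℤ.+ b) ℚ./ 1) (sym (ℤ.*-identityʳ (+ m))) (sym (ℤ.*-identityʳ (+ n)))

ℕtoℚ-* : ∀ m n → ℕtoℚ (m ℕ.* n) ≡ ℕtoℚ m * ℕtoℚ n
ℕtoℚ-* m n rewrite ℕtoℚ≡mkℚ m | ℕtoℚ≡mkℚ n = cong (ℚ._/ 1) (ℤ.pos-* m n)

ℕtoℚ-suc : ∀ n → ℕtoℚ (suc n) ≡ 1ℚ + ℕtoℚ n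
ℕtoℚ-suc = ℕtoℚ-+ 1

ℕtoℚ-2*suc : ∀ k → ℕtoℚ (2 ℕ.* suc k) ≡ 1ℚ + (1ℚ + ℕtoℚ (2 ℕ.* k))
ℕtoℚ-2*suc k =
  trans (cong ℕtoℚ (ℕ.*-suc 2 k)) (trans (ℕtoℚ-suc (suc (2 ℕ.* k))) (cong (_+_ 1ℚ) (ℕtoℚ-suc (2 ℕ.* k))))

ℕtoℚ-mono-≤ : ∀ {m n} → m ℕ.≤ n → ℕtoℚ m ≤ ℕtoℚ n
ℕtoℚ-mono-≤ {m} {n} m≤n rewrite ℕtoℚ≡mkℚ m | ℕtoℚ≡mkℚ n =
  *≤* (subst₂ ℤ._≤_ (sym (ℤ.*-identityʳ (+ m))) (sym (ℤ.*-identityʳ (+ n))) (ℤ.+≤+ m≤n))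

ℕtoℚ-mono-< : ∀ {m n} → m ℕ.< n → ℕtoℚ m < ℕtoℚ n
ℕtoℚ-mono-< {m} {n} m<n rewrite ℕtoℚ≡mkℚ m | ℕtoℚ≡mkℚ n =
  *<* (subst₂ ℤ._<_ (sym (ℤ.*-identityʳ (+ m))) (sym (ℤ.*-identityʳ (+ n))) (ℤ.+<+ m<n))

ℕtoℚ-cancel-< : ∀ {m n} → ℕtoℚ m < ℕtoℚ n → m ℕ.< n
ℕtoℚ-cancel-< {m} {n} m<n rewrite ℕtoℚ≡mkℚ m | ℕtoℚ≡mkℚ n with m<n
... | *<* lt = ℤ.drop‿+<+ (subst₂ ℤ._<_ (ℤ.*-identityʳ (+ m)) (ℤ.*-identityʳ (+ n)) lt)

ℕtoℚ-nonNeg : ∀ n → 0ℚ ≤ ℕtoℚ n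
ℕtoℚ-nonNeg n = ℕtoℚ-mono-≤ {0} {n} z≤n

ℕtoℚ-inverseˡ : ∀ k → (+ 1 ℚ./ suc k) * ℕtoℚ (suc k) ≡ 1ℚ
ℕtoℚ-inverseˡ k rewrite ℕtoℚ≡mkℚ (suc k) | normalize-coprime {1} {k} (1-coprimeTo (suc k)) =
  *-inverseˡ (mkℚ (+ suc k) 0 (Coprime.sym (1-coprimeTo (suc k))))

-- Lists of item sizes

total-↭ : ∀ {xs ys} → xs ↭ ys → total xs ≡ total ys
total-↭ xs↭ys = foldr-commMonoid +-0-isCommutativeMonoid (↭⇒↭ₛ xs↭ys)

total-nonNeg : ∀ {xs} → All (0ℚ ≤_) xs → 0ℚ ≤ total xs
total-nonNeg []         = ≤-refl
total-nonNeg (0≤x ∷ 0≤xs) = +-mono-≤ 0≤x (total-nonNeg 0≤xs)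

total-mono-⊆ : ∀ {xs ys} → All (0ℚ ≤_) ys → xs ⊆ ys → total xs ≤ total ys
total-mono-⊆ []           []           = ≤-refl
total-mono-⊆ {xs} (0≤y ∷ 0≤ys) (y ∷ʳ xs⊆ys) =
  ≤-trans (≤-reflexive (sym (+-identityˡ (total xs)))) (+-mono-≤ 0≤y (total-mono-⊆ 0≤ys xs⊆ys))
total-mono-⊆ (_ ∷ 0≤ys)   (_∷_ {x} refl xs⊆ys) = +-monoʳ-≤ x (total-mono-⊆ 0≤ys xs⊆ys)

length*≤total : ∀ {t xs} → All (t ≤_) xs → ℕtoℚ (length xs) * t ≤ total xs
length*≤total {t} {[]}     []           = ≤-reflexive (*-zeroˡ t)
length*≤total {t} {x ∷ xs} (t≤x ∷ t≤xs) = begin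
  ℕtoℚ (suc (length xs)) * t    ≡⟨ cong (_* t) (ℕtoℚ-suc (length xs)) ⟩
  (1ℚ + ℕtoℚ (length xs)) * t   ≡⟨ *-distribʳ-+ t 1ℚ (ℕtoℚ (length xs)) ⟩
  1ℚ * t + ℕtoℚ (length xs) * t ≤⟨ +-mono-≤ (≤-trans (≤-reflexive (*-identityˡ t)) t≤x)
                                           (length*≤total t≤xs) ⟩
  x + total xs                  ∎
  where open ≤-Reasoning

∃-length*≤total : ∀ {P : ℚ → Set} {xs} → All P xs → 0 ℕ.< length xs →
                ∃[ t ] P t × ℕtoℚ (length xs) * t ≤ total xs
∃-length*≤total {P} {x ∷ xs} (px ∷ pxs) _ =
  min x xs , argmin-all id {P = P} px pxs , length*≤total (min≤⊤ x xs ∷ min≤xs x xs)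

length-filter-mono-⊆ : ∀ {P : ℚ → Set} (P? : Decidable P) {xs ys} → xs ⊆ ys →
                       length (filter P? xs) ℕ.≤ length (filter P? ys)
length-filter-mono-⊆ P? xs⊆ys = length-mono-≤ (Sublist.filter⁺ P? P? (λ { refl → id }) xs⊆ys)

length-filter-↭ : ∀ {P : ℚ → Set} (P? : Decidable P) {xs ys} → xs ↭ ys →
                  length (filter P? xs) ≡ length (filter P? ys)
length-filter-↭ P? xs↭ys = ↭-length (filter-↭ P? xs↭ys)

⊆-↭-transport : ∀ {xs ys zs : List ℚ} → xs ⊆ ys → ys ↭ zs → ∃[ ws ] ws ⊆ zs × ws ↭ xs
⊆-↭-transport xs⊆ys ↭.refl = _ , xs⊆ys , ↭-refl
⊆-↭-transport (y ∷ʳ xs⊆ys) (↭.prep y ys↭zs) with ⊆-↭-transport xs⊆ys ys↭zs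
... | ws , ws⊆zs , ws↭xs = ws , y ∷ʳ ws⊆zs , ws↭xs
⊆-↭-transport (refl ∷ xs⊆ys) (↭.prep y ys↭zs) with ⊆-↭-transport xs⊆ys ys↭zs
... | ws , ws⊆zs , ws↭xs = y ∷ ws , refl ∷ ws⊆zs , ↭.prep y ws↭xs
⊆-↭-transport (x ∷ʳ (y ∷ʳ xs⊆ys)) (↭.swap x y ys↭zs) with ⊆-↭-transport xs⊆ys ys↭zs
... | ws , ws⊆zs , ws↭xs = ws , y ∷ʳ (x ∷ʳ ws⊆zs) , ws↭xs
⊆-↭-transport (x ∷ʳ (refl ∷ xs⊆ys)) (↭.swap x y ys↭zs) with ⊆-↭-transport xs⊆ys ys↭zs
... | ws , ws⊆zs , ws↭xs = y ∷ ws , refl ∷ (x ∷ʳ ws⊆zs) , ↭.prep y ws↭xs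
⊆-↭-transport (refl ∷ (y ∷ʳ xs⊆ys)) (↭.swap x y ys↭zs) with ⊆-↭-transport xs⊆ys ys↭zs
... | ws , ws⊆zs , ws↭xs = x ∷ ws , y ∷ʳ (refl ∷ ws⊆zs) , ↭.prep x ws↭xs
⊆-↭-transport (refl ∷ (refl ∷ xs⊆ys)) (↭.swap x y ys↭zs) with ⊆-↭-transport xs⊆ys ys↭zs
... | ws , ws⊆zs , ws↭xs = y ∷ x ∷ ws , refl ∷ (refl ∷ ws⊆zs) , ↭.swap y x ws↭xs
⊆-↭-transport xs⊆ys (↭.trans ys↭us us↭zs) with ⊆-↭-transport xs⊆ys ys↭us
... | vs , vs⊆us , vs↭xs with ⊆-↭-transport vs⊆us us↭zs
...   | ws , ws⊆zs , ws↭vs = ws , ws⊆zs , ↭-trans ws↭vs vs↭xs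

sorted-prefix-minimal : ∀ {xs ys} → AllPairs _≤_ ys → xs ⊆ ys → total (take (length xs) ys) ≤ total xs
sorted-prefix-minimal _ [] = ≤-refl
sorted-prefix-minimal (_ ∷ sorted) (_∷_ {y} refl xs⊆ys) = +-monoʳ-≤ y (sorted-prefix-minimal sorted xs⊆ys)
sorted-prefix-minimal {[]}     _                (_ ∷ʳ _)      = ≤-refl
sorted-prefix-minimal {x ∷ xs} (y≤ys ∷ sorted) (_ ∷ʳ x∷xs⊆ys) with All-resp-⊆ x∷xs⊆ys y≤ys
... | y≤x ∷ _ = +-mono-≤ y≤x (sorted-prefix-minimal sorted (∷ˡ⁻ x∷xs⊆ys))

-- Optimal solutions

∈-sublists⇒⊆ : ∀ {L} σ → L ∈ sublists σ → L ⊆ σ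
∈-sublists⇒⊆ []      (here refl) = []
∈-sublists⇒⊆ (x ∷ σ) L∈         = go (sublists σ) (∈-sublists⇒⊆ σ) L∈
  where
  go : ∀ Ls → (∀ {M} → M ∈ Ls → M ⊆ σ) →
       ∀ {L} → L ∈ foldr (λ ys acc → (x ∷ ys) ∷ ys ∷ acc) [] Ls → L ⊆ x ∷ σ
  go (M ∷ Ls) ⊆σ (here refl)         = refl ∷ ⊆σ (here refl)
  go (M ∷ Ls) ⊆σ (there (here refl)) = x ∷ʳ ⊆σ (here refl)
  go (M ∷ Ls) ⊆σ (there (there L∈))  = go Ls (⊆σ ∘ there) L∈

-- Opt σ unfolds to bestFit (sublists σ).
bestFit : List (List ℚ) → ℕ
bestFit = foldr (λ S m → if does (total S ≤? 1ℚ) then length S ⊔ m else m) 0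

bestFit-attained : ∀ Ls → bestFit Ls ≡ 0 ⊎ ∃[ L ] L ∈ Ls × total L ≤ 1ℚ × length L ≡ bestFit Ls
bestFit-attained []       = inj₁ refl
bestFit-attained (S ∷ Ls) = extend (total S ≤? 1ℚ) (bestFit-attained Ls)
  where
  Attained : List (List ℚ) → ℕ → Set
  Attained Ms n = n ≡ 0 ⊎ ∃[ L ] L ∈ Ms × total L ≤ 1ℚ × length L ≡ n

  weaken : ∀ {n} → Attained Ls n → Attained (S ∷ Ls) n
  weaken (inj₁ n≡0)               = inj₁ n≡0
  weaken (inj₂ (L , L∈ , fits , len)) = inj₂ (L , there L∈ , fits , len)

  extend : (d : Dec (total S ≤ 1ℚ)) → Attained Ls (bestFit Ls) →
           Attained (S ∷ Ls) (if does d then length S ⊔ bestFit Ls else bestFit Ls)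
  extend (no _)     ih = weaken ih
  extend (yes fits) ih with ℕ.⊔-sel (length S) (bestFit Ls)
  ... | inj₁ ⊔≡S  = inj₂ (S , here refl , fits , sym ⊔≡S)
  ... | inj₂ ⊔≡Ls = subst (Attained (S ∷ Ls)) (sym ⊔≡Ls) (weaken ih)

Opt-attained : ∀ σ → Opt σ ≡ 0 ⊎ ∃[ L ] L ⊆ σ × total L ≤ 1ℚ × length L ≡ Opt σ
Opt-attained σ with bestFit-attained (sublists σ)
... | inj₁ Opt≡0                 = inj₁ Opt≡0
... | inj₂ (L , L∈ , fits , len) = inj₂ (L , ∈-sublists⇒⊆ σ L∈ , fits , len)

sort-prefix-≤-sublist : ∀ {L σ} → L ⊆ σ →
                        total (take (length L) (sort σ)) ≤ total L ×
                        length (take (length L) (sort σ)) ≡ length L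
sort-prefix-≤-sublist {L} {σ} L⊆σ =
  let L′ , L′⊆sorted , L′↭L = ⊆-↭-transport L⊆σ (↭-sym (sort-↭ σ)) in
  subst (λ n → total (take n (sort σ)) ≤ total L × length (take n (sort σ)) ≡ n) (↭-length L′↭L)
    ( ≤-trans (sorted-prefix-minimal (Sorted⇒AllPairs totalOrder (sort-↗ σ)) L′⊆sorted)
              (≤-reflexive (total-↭ L′↭L))
    , trans (length-take (length L′) (sort σ)) (ℕ.m≤n⇒m⊓n≡m (length-mono-≤ L′⊆sorted)))

Opt-prefix-feasible : ∀ σ → total (take (Opt σ) (sort σ)) ≤ 1ℚ ×
                            length (take (Opt σ) (sort σ)) ≡ Opt σ
Opt-prefix-feasible σ with Opt-attained σ
... | inj₁ Opt≡0 rewrite Opt≡0 = nonNegative⁻¹ 1ℚ , refl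
... | inj₂ (L , L⊆σ , fits , len) rewrite sym len =
  Product.map₁ (λ ≤total → ≤-trans ≤total fits) (sort-prefix-≤-sublist L⊆σ)

avg*Opt : ∀ σ → avg σ * ℕtoℚ (Opt σ) ≡ total (take (Opt σ) (sort σ))
avg*Opt σ with Opt σ
... | zero  = refl
... | suc k = begin
  S * (+ 1 ℚ./ suc k) * ℕtoℚ (suc k)   ≡⟨ *-assoc S (+ 1 ℚ./ suc k) (ℕtoℚ (suc k)) ⟩
  S * ((+ 1 ℚ./ suc k) * ℕtoℚ (suc k)) ≡⟨ cong (S *_) (ℕtoℚ-inverseˡ k) ⟩
  S * 1ℚ                                ≡⟨ *-identityʳ S ⟩
  S                                     ∎
  where
  S = total (take (suc k) (sort σ))
  open ≡-Reasoning

-- √(ka) + √(a/(k+2)) ≤ √((k+2)a) without square roots: AM-GM with weight k + 1.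
sum-square-step : ∀ {a k z s} → 0ℚ ≤ a → 0ℚ ≤ k → s * s ≤ k * a →
                  (1ℚ + (1ℚ + k)) * (z * z) ≤ a → (z + s) * (z + s) ≤ (1ℚ + (1ℚ + k)) * a
sum-square-step {a} {k} {z} {s} 0≤a 0≤k s²≤ka mz²≤a = *-cancelˡ-≤-pos c {{ℚ.positive 0<c}} (begin
  c * ((z + s) * (z + s))                             ≤⟨ p≤p+q (square-nonNeg (c * z - s)) ⟩
  c * ((z + s) * (z + s)) + (c * z - s) * (c * z - s) ≡⟨ expand k z s ⟩
  c * (m * (z * z)) + m * (s * s)                     ≤⟨ +-mono-≤ (*-monoˡ-≤-nonNeg c {{c≥0}} mz²≤a)
                                                                  (*-monoˡ-≤-nonNeg m {{m≥0}} s²≤ka) ⟩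
  c * a + m * (k * a)                                 ≤⟨ p≤p+q 0≤a ⟩
  c * a + m * (k * a) + a                             ≡⟨ collect k a ⟩
  c * (m * a)                                         ∎)
  where
  open ≤-Reasoning
  c = 1ℚ + k
  m = 1ℚ + (1ℚ + k)
  0<c : 0ℚ < c
  0<c = +-mono-<-≤ (positive⁻¹ 1ℚ) 0≤k
  c≥0 = ℚ.nonNegative (<⇒≤ 0<c)
  m≥0 = ℚ.nonNegative (+-mono-≤ (nonNegative⁻¹ 1ℚ) (<⇒≤ 0<c))
  expand : ∀ k z s → let c = 1ℚ + k; m = 1ℚ + (1ℚ + k) in
           c * ((z + s) * (z + s)) + (c * z - s) * (c * z - s) ≡ c * (m * (z * z)) + m * (s * s)
  expand = Solver.solve-∀ ℚ-ring
  collect : ∀ k a → (1ℚ + k) * a + (1ℚ + (1ℚ + k)) * (k * a) + a ≡ (1ℚ + k) * ((1ℚ + (1ℚ + k)) * a)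
  collect = Solver.solve-∀ ℚ-ring

p+c<q⇒[p+q]*c<q*q : ∀ p q c → p ℕ.+ c ℕ.< q → (p ℕ.+ q) ℕ.* c ℕ.< q ℕ.* q
p+c<q⇒[p+q]*c<q*q p zero    c ()
p+c<q⇒[p+q]*c<q*q p (suc q) c p+c<q = begin-strict
  (p ℕ.+ suc q) ℕ.* c             ≡⟨ ℕ.*-distribʳ-+ c p (suc q) ⟩
  p ℕ.* c ℕ.+ suc q ℕ.* c         ≤⟨ ℕ.+-monoˡ-≤ (suc q ℕ.* c) (ℕ.*-monoʳ-≤ p c≤q) ⟩
  p ℕ.* suc q ℕ.+ suc q ℕ.* c     ≡⟨ regroup p (suc q) c ⟩
  suc q ℕ.* (p ℕ.+ c)             <⟨ ℕ.*-monoʳ-< (suc q) p+c<q ⟩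
  suc q ℕ.* suc q                 ∎
  where
  open ℕ.≤-Reasoning
  c≤q : c ℕ.≤ suc q
  c≤q = ℕ.<⇒≤ (ℕ.≤-<-trans (ℕ.m≤n+m c p) p+c<q)
  regroup : ∀ p q c → p ℕ.* q ℕ.+ q ℕ.* c ≡ q ℕ.* (p ℕ.+ c)
  regroup = ℕ-Solver.solve-∀

heavy⇒q*q<[p+q]*j : ∀ {a t S} p q j → 0 ℕ.< q → 0ℚ ≤ t → ℕtoℚ q * t ≤ S → S ≤ 1ℚ →
            S ≤ ℕtoℚ (p ℕ.+ q) * a → a < ℕtoℚ j * (t * t) → q ℕ.* q ℕ.< (p ℕ.+ q) ℕ.* j
heavy⇒q*q<[p+q]*j {a} {t} {S} p q j 0<q 0≤t qt≤S S≤1 S≤Na a<Kt² = ℕtoℚ-cancel-< (begin-strict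
  ℕtoℚ (q ℕ.* q)       ≡⟨ ℕtoℚ-* q q ⟩
  Q * Q                <⟨ *-monoʳ-<-pos Q {{ℚ.positive 0<Q}} Q<NKt ⟩
  Q * (N * K * t)      ≡⟨ swap-middle Q (N * K) t ⟩
  N * K * (Q * t)      ≤⟨ *-monoˡ-≤-nonNeg (N * K) {{ℚ.nonNegative 0≤NK}} (≤-trans qt≤S S≤1) ⟩
  N * K * 1ℚ           ≡⟨ *-identityʳ (N * K) ⟩
  N * K                ≡⟨ sym (ℕtoℚ-* (p ℕ.+ q) j) ⟩
  ℕtoℚ ((p ℕ.+ q) ℕ.* j) ∎)
  where
  open ≤-Reasoning
  swap-middle : ∀ x y z → x * (y * z) ≡ y * (x * z)
  swap-middle = Solver.solve-∀ ℚ-ring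
  reassoc : ∀ x y z → x * (y * (z * z)) ≡ x * y * z * z
  reassoc = Solver.solve-∀ ℚ-ring
  Q = ℕtoℚ q
  N = ℕtoℚ (p ℕ.+ q)
  K = ℕtoℚ j
  0<Q : 0ℚ < Q
  0<Q = ℕtoℚ-mono-< 0<q
  0<N : 0ℚ < N
  0<N = ℕtoℚ-mono-< (ℕ.<-≤-trans 0<q (ℕ.m≤n+m q p))
  0≤NK : 0ℚ ≤ N * K
  0≤NK = nonNegative⁻¹ (N * K)
    {{nonNeg*nonNeg⇒nonNeg N {{ℚ.nonNegative (<⇒≤ 0<N)}} K {{ℚ.nonNegative (ℕtoℚ-nonNeg j)}}}}
  Q<NKt : Q < N * K * t
  Q<NKt = *-cancelʳ-<-nonNeg t {{ℚ.nonNegative 0≤t}} (begin-strict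
    Q * t           ≤⟨ ≤-trans qt≤S S≤Na ⟩
    N * a           <⟨ *-monoʳ-<-pos N {{ℚ.positive 0<N}} a<Kt² ⟩
    N * (K * (t * t)) ≡⟨ reassoc N K t ⟩
    N * K * t * t   ∎)

-- The adaptive threshold algorithm

module _ (â : ℚ) .{{_ : NonNegative â}} where

  -- x exceeds T(j) = √(â/2j), squared to stay within ℚ.
  record Above (j : ℕ) (x : ℚ) : Set where
    constructor mkAbove
    field â<2jx² : â < ℕtoℚ (2 ℕ.* j) * (x * x)
  open Above

  above? : ∀ j → Decidable (Above j)
  above? j x = Dec.map′ mkAbove â<2jx² (â <? ℕtoℚ (2 ℕ.* j) * (x * x))

  #above #below : ℕ → List ℚ → ℕ
  #above j xs = length (filter (above? j) xs)
  #below j xs = length (filter (¬? ∘ above? j) xs)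

  -- The paper's i + 1: an arriving item is compared with T(next acc).
  next : List ℚ → ℕ
  next acc = suc (index â acc)

  FewAbove : List ℚ → Set
  FewAbove acc = ∀ j → #above (suc j) acc ℕ.≤ j

  Above-mono-index : ∀ {j k x} → j ℕ.≤ k → Above j x → Above k x
  Above-mono-index {x = x} j≤k (mkAbove a) = mkAbove $
    <-≤-trans a (*-monoʳ-≤-nonNeg (x * x) {{ℚ.nonNegative (square-nonNeg x)}}
                                  (ℕtoℚ-mono-≤ (ℕ.*-monoʳ-≤ 2 j≤k)))

  Above-mono-size : ∀ {j x y} → 0ℚ ≤ x → x ≤ y → Above j x → Above j y
  Above-mono-size {j} 0≤x x≤y (mkAbove a) = mkAbove $
    <-≤-trans a (*-monoˡ-≤-nonNeg (ℕtoℚ (2 ℕ.* j)) {{ℚ.nonNegative (ℕtoℚ-nonNeg (2 ℕ.* j))}}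
                                  (square-mono 0≤x x≤y))

  withinT⇒¬Above : ∀ {j x} → withinT â j x ≡ true → ¬ Above j x
  withinT⇒¬Above {j} {x} within = ≤⇒≯ (does-true⇒ (ℕtoℚ (2 ℕ.* j) * (x * x) ≤? â) within) ∘ â<2jx²

  ¬withinT⇒Above : ∀ {j x} → withinT â j x ≡ false → Above j x
  ¬withinT⇒Above {j} {x} = mkAbove ∘ ≰⇒> ∘ does-false⇒ (ℕtoℚ (2 ℕ.* j) * (x * x) ≤? â)

  #above-accept : ∀ j {x} xs → Above j x → #above j (x ∷ xs) ≡ suc (#above j xs)
  #above-accept j _ a = cong length (filter-accept (above? j) a)

  #above-reject : ∀ j {x} xs → ¬ Above j x → #above j (x ∷ xs) ≡ #above j xs
  #above-reject j _ ¬a = cong length (filter-reject (above? j) ¬a)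

  #below-accept : ∀ j {x} xs → ¬ Above j x → #below j (x ∷ xs) ≡ suc (#below j xs)
  #below-accept j _ ¬a = cong length (filter-accept (¬? ∘ above? j) ¬a)

  #below-reject : ∀ j {x} xs → Above j x → #below j (x ∷ xs) ≡ #below j xs
  #below-reject j _ a = cong length (filter-reject (¬? ∘ above? j) (λ ¬a → ¬a a))

  #below+#above : ∀ j xs → #below j xs ℕ.+ #above j xs ≡ length xs
  #below+#above j xs =
    trans (ℕ.+-comm (#below j xs) (#above j xs)) (sym (interleave-length (Interleaving.filter⁺ (above? j) xs)))

  -- Case splits on a decision go through a helper applied to it: a with-abstraction
  -- would normalise the goal, which is prohibitively expensive for these terms.
  countAbove≡#above : ∀ j xs → countAbove â j xs ≡ #above j xs
  countAbove≡#above j []       = refl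
  countAbove≡#above j (x ∷ xs) = step (above? j x)
    where
    step : (d : Dec (Above j x)) →
           (if does d then suc (countAbove â j xs) else countAbove â j xs) ≡ #above j (x ∷ xs)
    step (yes a)  = trans (cong suc (countAbove≡#above j xs)) (sym (#above-accept j xs a))
    step (no ¬a)  = trans (countAbove≡#above j xs) (sym (#above-reject j xs ¬a))

  searchIdx-fixed : ∀ {acc} → FewAbove acc → ∀ n →
                    #above (suc (searchIdx â acc n)) acc ≡ searchIdx â acc n
  searchIdx-fixed few zero    = ℕ.n≤0⇒n≡0 (few 0)
  searchIdx-fixed {acc} few (suc n) = pick (countAbove â (suc (suc n)) acc ℕ.≟ suc n)
    where
    pick : (d : Dec (countAbove â (suc (suc n)) acc ≡ suc n)) →
           let i = if does d then suc n else searchIdx â acc n in #above (suc i) acc ≡ i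
    pick (yes fixed) = trans (sym (countAbove≡#above (suc (suc n)) acc)) fixed
    pick (no _)      = searchIdx-fixed few n

  fixed⇒≤searchIdx : ∀ {acc j} n → j ℕ.≤ n → #above (suc j) acc ≡ j → j ℕ.≤ searchIdx â acc n
  fixed⇒≤searchIdx zero    z≤n _ = z≤n
  fixed⇒≤searchIdx {acc} {j} (suc n) j≤1+n fixed = pick (countAbove â (suc (suc n)) acc ℕ.≟ suc n)
    where
    pick : (d : Dec (countAbove â (suc (suc n)) acc ≡ suc n)) →
           j ℕ.≤ (if does d then suc n else searchIdx â acc n)
    pick (yes _)        = j≤1+n
    pick (no not-fixed) = fixed⇒≤searchIdx n (ℕ.s≤s⁻¹ (ℕ.≤∧≢⇒< j≤1+n j≢1+n)) fixed
      where
      j≢1+n : j ≢ suc n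
      j≢1+n refl = not-fixed (trans (countAbove≡#above (suc (suc n)) acc) fixed)

  index-fixed : ∀ {acc} → FewAbove acc → #above (next acc) acc ≡ index â acc
  index-fixed {acc} few = searchIdx-fixed few (length acc)

  fixed⇒≤index : ∀ {acc j} → #above (suc j) acc ≡ j → j ℕ.≤ index â acc
  fixed⇒≤index {acc} {j} fixed =
    fixed⇒≤searchIdx (length acc) (subst (ℕ._≤ length acc) fixed (length-filter (above? (suc j)) acc)) fixed

  FewAbove-accept : ∀ {acc x} → FewAbove acc → ¬ Above (next acc) x → FewAbove (x ∷ acc)
  FewAbove-accept {acc} {x} few x-fits j = bound (above? (suc j) x)
    where
    bound : Dec (Above (suc j) x) → #above (suc j) (x ∷ acc) ℕ.≤ j
    bound (no ¬a) = ℕ.≤-trans (ℕ.≤-reflexive (#above-reject (suc j) acc ¬a)) (few j)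
    bound (yes a) =
      ℕ.≤-trans (ℕ.≤-reflexive (#above-accept (suc j) acc a)) (ℕ.≤∧≢⇒< (few j) not-fixed)
      where
      index<j : index â acc ℕ.< j
      index<j = ℕ.≰⇒> (λ j≤index → x-fits (Above-mono-index {x = x} (s≤s j≤index) a))
      not-fixed : #above (suc j) acc ≢ j
      not-fixed fixed = ℕ.<⇒≱ index<j (fixed⇒≤index {acc} fixed)

  index-accept : ∀ {acc x} → FewAbove acc → ¬ Above (next acc) x → index â acc ℕ.≤ index â (x ∷ acc)
  index-accept {acc} {x} few x-fits =
    fixed⇒≤index {x ∷ acc} (trans (#above-reject (next acc) acc x-fits) (index-fixed {acc} few))

  FewAbove-∷⁻ : ∀ {x xs} → FewAbove (x ∷ xs) → FewAbove xs
  FewAbove-∷⁻ {x} few j = ℕ.≤-trans (length-filter-mono-⊆ (above? (suc j)) (x ∷ʳ ⊆-refl)) (few j)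

  FewAbove-↭ : ∀ {xs ys} → xs ↭ ys → FewAbove xs → FewAbove ys
  FewAbove-↭ xs↭ys few j = subst (ℕ._≤ j) (length-filter-↭ (above? (suc j)) xs↭ys) (few j)

  sorted-FewAbove-total² : ∀ {zs} → AllPairs _≤_ zs → All (0ℚ ≤_) zs → FewAbove zs →
                           total zs * total zs ≤ ℕtoℚ (2 ℕ.* length zs) * â
  sorted-FewAbove-total² [] [] _ = ≤-reflexive (sym (*-zeroˡ â))
  sorted-FewAbove-total² {z ∷ zs} (z≤zs ∷ sorted) (0≤z ∷ 0≤zs) few =
    subst (λ c → (z + total zs) * (z + total zs) ≤ c * â) (sym (ℕtoℚ-2*suc K))
      (sum-square-step {z = z} {s = total zs} (nonNegative⁻¹ â) (ℕtoℚ-nonNeg (2 ℕ.* K))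
        (sorted-FewAbove-total² sorted 0≤zs (FewAbove-∷⁻ few))
        (subst (λ c → c * (z * z) ≤ â) (ℕtoℚ-2*suc K) (≮⇒≥ (z-fits ∘ mkAbove))))
    where
    K = length zs
    z-fits : ¬ Above (suc K) z
    z-fits a = ℕ.1+n≰n (subst (ℕ._≤ K) all-above (few K))
      where
      all-above : #above (suc K) (z ∷ zs) ≡ suc K
      all-above = cong length (filter-all (above? (suc K))
        (a ∷ All.map (λ z≤y → Above-mono-size {suc K} 0≤z z≤y a) z≤zs))

  FewAbove-total² : ∀ {ys} → All (0ℚ ≤_) ys → FewAbove ys →
                    total ys * total ys ≤ ℕtoℚ (2 ℕ.* length ys) * â
  FewAbove-total² {ys} 0≤ys few =
    subst₂ (λ t n → t * t ≤ ℕtoℚ (2 ℕ.* n) * â) (total-↭ (sort-↭ ys)) (↭-length (sort-↭ ys))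
      (sorted-FewAbove-total² (Sorted⇒AllPairs totalOrder (sort-↗ ys))
        (All-resp-↭ ys↭sorted 0≤ys) (FewAbove-↭ ys↭sorted few))
    where
    ys↭sorted = ↭-sym (sort-↭ ys)

  infix 4 _⇝_
  data _⇝_ : List ℚ → List ℚ → Set where
    done   : ∀ {acc} → acc ⇝ acc
    accept : ∀ {acc fin x} → ¬ Above (next acc) x → x ∷ acc ⇝ fin → acc ⇝ fin

  ⇝-FewAbove : ∀ {acc fin} → FewAbove acc → acc ⇝ fin → FewAbove fin
  ⇝-FewAbove few done                = few
  ⇝-FewAbove few (accept x-fits rest) = ⇝-FewAbove (FewAbove-accept few x-fits) rest

  ⇝-index : ∀ {acc fin} → FewAbove acc → acc ⇝ fin → index â acc ℕ.≤ index â fin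
  ⇝-index few done                = ℕ.≤-refl
  ⇝-index {acc} few (accept {x = x} x-fits rest) =
    ℕ.≤-trans (index-accept {acc} {x} few x-fits) (⇝-index (FewAbove-accept few x-fits) rest)

  ⇝-length : ∀ {acc fin} → acc ⇝ fin → length acc ℕ.≤ length fin
  ⇝-length done            = ℕ.≤-refl
  ⇝-length (accept _ rest) = ℕ.<⇒≤ (⇝-length rest)

  -- How runAT treats the next item, indexed by the rest of the run; runAT-step is the
  -- only place where the definition of runAT is unfolded.
  data RunStep (acc : List ℚ) (level x : ℚ) (σ : List ℚ) : List ℚ → Set where
    fits     : ¬ Above (next acc) x → level + x ≤ 1ℚ →
               RunStep acc level x σ (runAT â (x ∷ acc) (level + x) σ)
    overflow : ¬ Above (next acc) x → 1ℚ < level + x → RunStep acc level x σ (runAT â acc level σ)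
    too-big  : Above (next acc) x → RunStep acc level x σ (runAT â acc level σ)

  runAT-step : ∀ acc level x σ → RunStep acc level x σ (runAT â acc level (x ∷ σ))
  runAT-step acc level x σ with withinT â (next acc) x in within
  ... | false = too-big (¬withinT⇒Above within)
  ... | true  = by-level (level + x ≤? 1ℚ)
    where
    by-level : (d : Dec (level + x ≤ 1ℚ)) →
               RunStep acc level x σ (if does d then runAT â (x ∷ acc) (level + x) σ else runAT â acc level σ)
    by-level (yes room) = fits (withinT⇒¬Above within) room
    by-level (no ¬room) = overflow (withinT⇒¬Above within) (≰⇒> ¬room)

  runAT-⇝ : ∀ acc level σ → acc ⇝ runAT â acc level σ
  runAT-⇝ acc level []      = done
  runAT-⇝ acc level (x ∷ σ) = step (runAT-step acc level x σ)
    where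
    step : ∀ {fin} → RunStep acc level x σ fin → acc ⇝ fin
    step (fits x-fits _) = accept x-fits (runAT-⇝ (x ∷ acc) (level + x) σ)
    step (overflow _ _)  = runAT-⇝ acc level σ
    step (too-big _)     = runAT-⇝ acc level σ

  #below-shift : ∀ j x σ acc → #below j (x ∷ σ) ℕ.+ #below j acc ≡ #below j σ ℕ.+ #below j (x ∷ acc)
  #below-shift j x σ acc = shift (above? j x)
    where
    open ≡-Reasoning
    shift : Dec (Above j x) → #below j (x ∷ σ) ℕ.+ #below j acc ≡ #below j σ ℕ.+ #below j (x ∷ acc)
    shift (yes a) = trans (cong (ℕ._+ #below j acc) (#below-reject j σ a))
                          (cong (#below j σ ℕ.+_) (sym (#below-reject j acc a)))
    shift (no ¬a) = begin
      #below j (x ∷ σ) ℕ.+ #below j acc ≡⟨ cong (ℕ._+ #below j acc) (#below-accept j σ ¬a) ⟩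
      suc (#below j σ ℕ.+ #below j acc) ≡⟨ sym (ℕ.+-suc (#below j σ) (#below j acc)) ⟩
      #below j σ ℕ.+ suc (#below j acc) ≡⟨ cong (#below j σ ℕ.+_) (sym (#below-accept j acc ¬a)) ⟩
      #below j σ ℕ.+ #below j (x ∷ acc) ∎

  overflow-bound : ∀ {acc x m} → All (0ℚ ≤_) (x ∷ acc) → FewAbove acc → ¬ Above (next acc) x →
                   1ℚ < total (x ∷ acc) → length acc ℕ.≤ m → 1ℚ < ℕtoℚ (2 ℕ.* suc m) * â
  overflow-bound {acc} {x} {m} 0≤ few x-fits 1<T acc≤m = begin-strict
    1ℚ                                 <⟨ 1<T ⟩
    T                                  ≡⟨ sym (*-identityʳ T) ⟩
    T * 1ℚ                             ≤⟨ *-monoˡ-≤-nonNeg T {{ℚ.nonNegative (total-nonNeg 0≤)}} (<⇒≤ 1<T) ⟩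
    T * T                              ≤⟨ FewAbove-total² 0≤ (FewAbove-accept few x-fits) ⟩
    ℕtoℚ (2 ℕ.* suc (length acc)) * â ≤⟨ *-monoʳ-≤-nonNeg â (ℕtoℚ-mono-≤ (ℕ.*-monoʳ-≤ 2 (s≤s acc≤m))) ⟩
    ℕtoℚ (2 ℕ.* suc m) * â            ∎
    where
    open ≤-Reasoning
    T = total (x ∷ acc)

  -- Either an item under the threshold did not fit, which forces the first alternative,
  -- or every item of σ under the final threshold was accepted.
  OverflowOrKept : List ℚ → List ℚ → List ℚ → Set
  OverflowOrKept σ acc fin =
    1ℚ < ℕtoℚ (2 ℕ.* suc (length fin)) * â ⊎
    #below (next fin) σ ℕ.+ #below (next fin) acc ℕ.≤ #below (next fin) fin

  runAT-overflows-or-keeps : ∀ {acc level} σ → All (0ℚ ≤_) σ → All (0ℚ ≤_) acc → FewAbove acc →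
                             level ≡ total acc → OverflowOrKept σ acc (runAT â acc level σ)
  runAT-overflows-or-keeps [] _ _ _ _ = inj₂ ℕ.≤-refl
  runAT-overflows-or-keeps {acc} {level} (x ∷ σ) (0≤x ∷ 0≤σ) 0≤acc few level≡acc =
    step (runAT-step acc level x σ)
    where
    level+x≡total : level + x ≡ total (x ∷ acc)
    level+x≡total = trans (cong (_+ x) level≡acc) (+-comm (total acc) x)
    step : ∀ {fin} → RunStep acc level x σ fin → OverflowOrKept (x ∷ σ) acc fin
    step {fin} (fits x-fits _) =
      Sum.map₂ (ℕ.≤-trans (ℕ.≤-reflexive (#below-shift (next fin) x σ acc)))
        (runAT-overflows-or-keeps σ 0≤σ (0≤x ∷ 0≤acc) (FewAbove-accept few x-fits) level+x≡total)
    step (overflow x-fits 1<level+x) =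
      inj₁ (overflow-bound (0≤x ∷ 0≤acc) few x-fits (<-≤-trans 1<level+x (≤-reflexive level+x≡total))
        (⇝-length (runAT-⇝ acc level σ)))
    step {fin} (too-big x-big) =
      Sum.map₂ (ℕ.≤-trans (ℕ.≤-reflexive
                 (cong (ℕ._+ #below (next fin) acc) (#below-reject (next fin) σ still-big))))
        (runAT-overflows-or-keeps σ 0≤σ 0≤acc few level≡acc)
      where
      still-big : Above (next fin) x
      still-big = Above-mono-index (s≤s (⇝-index few (runAT-⇝ acc level σ))) x-big

  #above≤#below+2j : ∀ j {O} → All (0ℚ ≤_) O → total O ≤ 1ℚ → total O ≤ ℕtoℚ (length O) * â →
                     #above j O ℕ.≤ #below j O ℕ.+ 2 ℕ.* j
  #above≤#below+2j j {O} 0≤O O≤1 O≤nâ = ℕ.≮⇒≥ too-many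
    where
    p = #below j O
    q = #above j O
    heavy : All (λ t → Above j t × 0ℚ ≤ t) (filter (above? j) O)
    heavy = All.zip (all-filter (above? j) O , All-resp-⊆ (filter-⊆ (above? j) O) 0≤O)
    too-many : ¬ (p ℕ.+ 2 ℕ.* j ℕ.< q)
    too-many p+2j<q =
      let 0<q = ℕ.≤-<-trans z≤n p+2j<q
          t , (t-big , 0≤t) , qt≤ = ∃-length*≤total heavy 0<q
      in ℕ.<-asym (p+c<q⇒[p+q]*c<q*q p q (2 ℕ.* j) p+2j<q)
           (heavy⇒q*q<[p+q]*j p q (2 ℕ.* j) 0<q 0≤t
             (≤-trans qt≤ (total-mono-⊆ 0≤O (filter-⊆ (above? j) O))) O≤1
             (subst (λ n → total O ≤ ℕtoℚ n * â) (sym (#below+#above j O)) O≤nâ) (â<2jx² t-big))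

  total≤2[#below+j]â : ∀ j {O} → All (0ℚ ≤_) O → total O ≤ 1ℚ → total O ≤ ℕtoℚ (length O) * â →
                total O ≤ ℕtoℚ (2 ℕ.* (#below j O ℕ.+ j)) * â
  total≤2[#below+j]â j {O} 0≤O O≤1 O≤nâ = ≤-trans O≤nâ (*-monoʳ-≤-nonNeg â (ℕtoℚ-mono-≤ (begin
    length O              ≡⟨ sym (#below+#above j O) ⟩
    p ℕ.+ q               ≤⟨ ℕ.+-monoʳ-≤ p (#above≤#below+2j j 0≤O O≤1 O≤nâ) ⟩
    p ℕ.+ (p ℕ.+ 2 ℕ.* j) ≡⟨ double p j ⟩
    2 ℕ.* (p ℕ.+ j)       ∎)))
    where
    open ℕ.≤-Reasoning
    p = #below j O
    q = #above j O
    double : ∀ p j → p ℕ.+ (p ℕ.+ 2 ℕ.* j) ≡ 2 ℕ.* (p ℕ.+ j)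
    double = ℕ-Solver.solve-∀

  feasible≤2[1+ATup]â : ∀ {σ ys O} → All (0ℚ ≤_) σ → ys ↭ σ → O ⊆ ys →
                        total O ≤ 1ℚ → total O ≤ ℕtoℚ (length O) * â →
                        total O ≤ ℕtoℚ (2 ℕ.* suc (ATup â σ)) * â
  feasible≤2[1+ATup]â {σ} {ys} {O} 0≤σ ys↭σ O⊆ys O≤1 O≤nâ =
    conclude (runAT-overflows-or-keeps σ 0≤σ [] (λ _ → z≤n) refl)
    where
    fin = runAT â [] 0ℚ σ
    J = next fin

    0≤O : All (0ℚ ≤_) O
    0≤O = All-resp-⊆ O⊆ys (All-resp-↭ (↭-sym ys↭σ) 0≤σ)

    fin-split : #below J fin ℕ.+ index â fin ≡ length fin
    fin-split = trans (cong (#below J fin ℕ.+_) (sym (index-fixed {fin} few-fin))) (#below+#above J fin)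
      where
      few-fin : FewAbove fin
      few-fin = ⇝-FewAbove (λ _ → z≤n) (runAT-⇝ [] 0ℚ σ)

    conclude : OverflowOrKept σ [] fin → total O ≤ ℕtoℚ (2 ℕ.* suc (length fin)) * â
    conclude (inj₁ overflowed) = ≤-trans O≤1 (<⇒≤ overflowed)
    conclude (inj₂ below-kept) = ≤-trans (total≤2[#below+j]â J 0≤O O≤1 O≤nâ)
                                         (*-monoʳ-≤-nonNeg â (ℕtoℚ-mono-≤ (ℕ.*-monoʳ-≤ 2 p+J≤)))
      where
      open ℕ.≤-Reasoning
      p+J≤ : #below J O ℕ.+ J ℕ.≤ suc (length fin)
      p+J≤ = begin
        #below J O ℕ.+ J                   ≤⟨ ℕ.+-monoˡ-≤ J (length-filter-mono-⊆ (¬? ∘ above? J) O⊆ys) ⟩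
        #below J ys ℕ.+ J                  ≡⟨ cong (ℕ._+ J) (length-filter-↭ (¬? ∘ above? J) ys↭σ) ⟩
        #below J σ ℕ.+ J                   ≤⟨ ℕ.+-monoˡ-≤ J (ℕ.≤-trans (ℕ.m≤m+n _ 0) below-kept) ⟩
        #below J fin ℕ.+ J                 ≡⟨ ℕ.+-suc (#below J fin) (index â fin) ⟩
        suc (#below J fin ℕ.+ index â fin) ≡⟨ cong suc fin-split ⟩
        suc (length fin)                   ∎

-- The competitive ratio

module _ {â : ℚ} .{{_ : Positive â}} where

  private
    v : ℚ
    v = (1/ â) {{pos⇒nonZero â}}

  a/â<1⇒a*n≤n*â : ∀ {a} n → a * v < 1ℚ → a * ℕtoℚ n ≤ ℕtoℚ n * â
  a/â<1⇒a*n≤n*â {a} n av<1 = begin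
    a * ℕtoℚ n ≤⟨ *-monoʳ-≤-nonNeg (ℕtoℚ n) {{ℚ.nonNegative (ℕtoℚ-nonNeg n)}} (<⇒≤ a<â) ⟩
    â * ℕtoℚ n ≡⟨ *-comm â (ℕtoℚ n) ⟩
    ℕtoℚ n * â ∎
    where
    open ≤-Reasoning
    a<â : a < â
    a<â = begin-strict
      a             ≡⟨ sym (*-identityʳ a) ⟩
      a * 1ℚ        ≡⟨ cong (a *_) (sym (*-inverseˡ â {{pos⇒nonZero â}})) ⟩
      a * (v * â)   ≡⟨ sym (*-assoc a v â) ⟩
      a * v * â     <⟨ *-monoˡ-<-pos â av<1 ⟩
      1ℚ * â        ≡⟨ *-identityˡ â ⟩
      â             ∎

  ratio-bound : ∀ {a} n m → a * ℕtoℚ n ≤ ℕtoℚ (2 ℕ.* suc m) * â →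
                ((a * v) * ½) * ℕtoℚ n - 1ℚ ≤ ℕtoℚ m
  ratio-bound {a} n m an≤ = begin
    a * v * ½ * ℕtoℚ n - 1ℚ                   ≡⟨ cong (_- 1ℚ) (regroup a v ½ (ℕtoℚ n)) ⟩
    a * ℕtoℚ n * (v * ½) - 1ℚ                 ≤⟨ +-monoˡ-≤ (ℚ.- 1ℚ) (*-monoʳ-≤-nonNeg (v * ½) {{v½≥0}} an≤) ⟩
    ℕtoℚ (2 ℕ.* suc m) * â * (v * ½) - 1ℚ    ≡⟨ cong (λ x → x * â * (v * ½) - 1ℚ) two-suc ⟩
    ℕtoℚ 2 * (1ℚ + M) * â * (v * ½) - 1ℚ     ≡⟨ regroup₂ (ℕtoℚ 2) M â v ½ ⟩
    ℕtoℚ 2 * ½ * (â * v) * (1ℚ + M) - 1ℚ     ≡⟨ cong (λ x → ℕtoℚ 2 * ½ * x * (1ℚ + M) - 1ℚ)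
                                                      (*-inverseʳ â {{pos⇒nonZero â}}) ⟩
    1ℚ * 1ℚ * (1ℚ + M) - 1ℚ                  ≡⟨ cancel M ⟩
    M                                         ∎
    where
    open ≤-Reasoning
    M = ℕtoℚ m
    v½≥0 = pos⇒nonNeg (v * ½) {{pos*pos⇒pos v {{1/pos⇒pos â}} ½}}
    two-suc : ℕtoℚ (2 ℕ.* suc m) ≡ ℕtoℚ 2 * (1ℚ + M)
    two-suc = trans (ℕtoℚ-* 2 (suc m)) (cong (ℕtoℚ 2 *_) (ℕtoℚ-suc m))
    regroup : ∀ a v h n → a * v * h * n ≡ a * n * (v * h)
    regroup = Solver.solve-∀ ℚ-ring
    regroup₂ : ∀ t M â v h → t * (1ℚ + M) * â * (v * h) - 1ℚ ≡ t * h * (â * v) * (1ℚ + M) - 1ℚ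
    regroup₂ = Solver.solve-∀ ℚ-ring
    cancel : ∀ M → 1ℚ * 1ℚ * (1ℚ + M) - 1ℚ ≡ M
    cancel = Solver.solve-∀ ℚ-ring

theorem14 : (â : ℚ) → .{{_ : Positive â}} → (σ : List ℚ) →
    All (λ x → 0ℚ < x × x ≤ 1ℚ) σ →
    avg σ * (1/ â) {{pos⇒nonZero â}} < 1ℚ →
    ((avg σ * (1/ â) {{pos⇒nonZero â}}) * ½) * ℕtoℚ (Opt σ) - 1ℚ ≤ ℕtoℚ (ATup â σ)
theorem14 â σ items ratio<1 = ratio-bound {a = avg σ} (Opt σ) (ATup â σ) (begin
  avg σ * ℕtoℚ (Opt σ)            ≡⟨ avg*Opt σ ⟩
  total O                         ≤⟨ feasible≤2[1+ATup]â â {{pos⇒nonNeg â}}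
                                       0≤σ (sort-↭ σ) (take-⊆ (Opt σ) (sort σ)) O-fits O-average ⟩
  ℕtoℚ (2 ℕ.* suc (ATup â σ)) * â ∎)
  where
  open ≤-Reasoning
  O = take (Opt σ) (sort σ)
  0≤σ : All (0ℚ ≤_) σ
  0≤σ = All.map (<⇒≤ ∘ proj₁) items
  O-fits : total O ≤ 1ℚ
  O-fits = proj₁ (Opt-prefix-feasible σ)
  O-average : total O ≤ ℕtoℚ (length O) * â
  O-average = begin
    total O              ≡⟨ sym (avg*Opt σ) ⟩
    avg σ * ℕtoℚ (Opt σ) ≤⟨ a/â<1⇒a*n≤n*â {â} {avg σ} (Opt σ) ratio<1 ⟩
    ℕtoℚ (Opt σ) * â     ≡⟨ cong (λ n → ℕtoℚ n * â) (sym (proj₂ (Opt-prefix-feasible σ))) ⟩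
    ℕtoℚ (length O) * â  ∎
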